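{- Let $G$ be a Hamiltonian graph on $n$ vertices. Then for every integer $k \geq 1$, $\gamma_{all,k}^\infty(G) \leq \lceil \frac{n}{2k+1}\rceil$.
   Context: Graphs are finite and simple; $d(u,v)$ is graph distance and $N_k[x]=\{v: d(x,v)\le k\}$. A multiset $D$ of vertices of $G$ is a distance-$k$ dominating set if every vertex of $V(G)\setminus D$ is at distance at most $k$ from some element of $D$. Let $\mathbb{D}_{k,q}(G)$ be the set of such multisets of cardinality $q$. $D=\{v_1,\dots,v_q\}$ transforms to $D'=\{u_1,\dots,u_q\}$ if (for some indexing) $u_i\in N_k[v_i]$ for all $i$. An eternal distance-$k$ dominating family is $\mathcal{E}\subseteq\mathbb{D}_{k,q}(G)$ for some $q$ such that for every $D\in\mathcal{E}$ and every vertex $v$ there is $D'\in\mathcal{E}$ with $v\in D'$ and $D$ transforms to $D'$. $\gamma_{all,k}^\infty(G)$ is the minimum $q$ for which such a family exists. -}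

module Defs where

open import Level using (0ℓ)
open import Data.Nat using (ℕ; zero; suc; _+_; _*_; _≤_)
open import Data.Nat.DivMod using (_/_; _mod_)
open import Data.Fin using (Fin; toℕ)
open import Data.Fin.Permutation using (Permutation′; _⟨$⟩ʳ_)
open import Data.Vec using (Vec; lookup)
open import Data.Vec.Membership.Propositional using (_∈_)
open import Data.Product using (Σ; Σ-syntax; ∃; ∃-syntax; _×_)
open import Data.Sum using (_⊎_)
open import Data.Empty using (⊥)
open import Relation.Nullary using (¬_)
open import Relation.Binary.PropositionalEquality using (_≡_)

record Graph (n : ℕ) : Set₁ where
  field
    Adj   : Fin n → Fin n → Set
    irrefl : ∀ u → ¬ Adj u u
    sym    : ∀ {u v} → Adj u v → Adj v u
open Graph public

Within : ∀ {n} → Graph n → ℕ → Fin n → Fin n → Set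
Within G zero    u v = u ≡ v
Within G (suc k) u v = u ≡ v ⊎ Σ[ w ∈ Fin _ ] (Adj G u w × Within G k w v)

Hamiltonian : ∀ {n} → Graph n → Set
Hamiltonian {zero}  G = ⊥
Hamiltonian {suc m} G =
  2 ≤ m × Σ[ c ∈ Permutation′ (suc m) ]
    (∀ (i : Fin (suc m)) → Adj G (c ⟨$⟩ʳ i) (c ⟨$⟩ʳ (suc (toℕ i) mod suc m)))

-- Multisets of q vertices are represented by vectors of length q
-- (a multiset is a vector up to reordering; all notions below are
-- invariant under reordering).
Config : ℕ → ℕ → Set
Config n q = Vec (Fin n) q

Dominating : ∀ {n q} → Graph n → ℕ → Config n q → Set
Dominating {n} G k D = ∀ (v : Fin n) → ¬ (v ∈ D) → Σ[ i ∈ Fin _ ] Within G k (lookup D i) v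

Transforms : ∀ {n q} → Graph n → ℕ → Config n q → Config n q → Set
Transforms {q = q} G k D D' =
  Σ[ π ∈ Permutation′ q ] (∀ i → Within G k (lookup D i) (lookup D' (π ⟨$⟩ʳ i)))

record EternalFamily {n} (G : Graph n) (k q : ℕ) : Set₁ where
  field
    Member    : Config n q → Set
    nonempty  : Σ[ D ∈ Config n q ] Member D
    dominates : ∀ D → Member D → Dominating G k D
    respond   : ∀ D → Member D → ∀ (v : Fin n) →
                Σ[ D' ∈ Config n q ] (Member D' × v ∈ D' × Transforms G k D D')

EternalDomNumber≤ : ∀ {n} → Graph n → ℕ → ℕ → Set₁
EternalDomNumber≤ G k m = Σ[ q ∈ ℕ ] (q ≤ m × EternalFamily G k q)

-- ⌈ n / (2k+1) ⌉
ceilDiv2k+1 : ℕ → ℕ → ℕ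
ceilDiv2k+1 n k = (n + 2 * k) / suc (2 * k)

-- Number the vertices along the Hamiltonian cycle and place a guard on every
-- (2k+1)-th one, ⌈n/(2k+1)⌉ guards in all; the family consists of all
-- rotations of this configuration. Every vertex lies within k of a guard
-- along the cycle, and rotating all guards by at most k steps, forwards or
-- backwards, brings some guard onto any prescribed vertex. The only delicate
-- point is the final gap of the cycle, which may be shorter than 2k+1.
module Submission where

open import Defs hiding (sym)
open import Data.Nat using (ℕ; zero; suc; _+_; _*_; _∸_; _≤_; _<_; z≤n; s≤s; _≤?_)
open import Data.Nat.Properties
open import Data.Nat.DivMod
open import Data.Nat.Tactic.RingSolver using (solve-∀)
open import Data.Fin using (Fin; toℕ; fromℕ<)
open import Data.Fin.Properties using (toℕ-fromℕ<; fromℕ<-cong; fromℕ<-toℕ; toℕ<n)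
open import Data.Fin.Permutation using (Permutation′; _⟨$⟩ʳ_; _⟨$⟩ˡ_; inverseʳ; id)
open import Data.Vec using (lookup; tabulate)
open import Data.Vec.Membership.Propositional using (_∈_)
open import Data.Vec.Properties using (lookup∘tabulate)
open import Data.Vec.Membership.Propositional.Properties using (∈-lookup)
open import Data.Product using (Σ; ∃; _×_; _,_)
open import Data.Sum using (inj₁; inj₂)
open import Relation.Nullary using (yes; no)
open import Relation.Binary.PropositionalEquality
  using (_≡_; refl; sym; trans; cong; subst; subst₂; module ≡-Reasoning)

Within-mono : ∀ {n} {G : Graph n} {t k u v} → t ≤ k → Within G t u v → Within G k u v
Within-mono {t = zero} {zero}  z≤n       u≡v                = u≡v
Within-mono {t = zero} {suc k} z≤n       u≡v                = inj₁ u≡v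
Within-mono                    (s≤s t≤k) (inj₁ u≡v)         = inj₁ u≡v
Within-mono                    (s≤s t≤k) (inj₂ (w , a , r)) = inj₂ (w , a , Within-mono t≤k r)

below-ceilDiv2k+1 : ∀ {N} k j → j * suc (2 * k) < N → j < ceilDiv2k+1 N k
below-ceilDiv2k+1 {N} k j jK<N =
  subst (_≤ ceilDiv2k+1 N k) (m*n/n≡m (suc j) K) (/-monoˡ-≤ K bound)
  where
  K = suc (2 * k)
  bound : suc j * K ≤ N + 2 * k
  bound = subst₂ _≤_ (+-suc (2 * k) (j * K)) (+-comm (2 * k) N) (+-monoʳ-≤ (2 * k) jK<N)

-- Offset d on a cycle of length N is hit by guard j of the configuration with
-- guards at 0, K, 2K, … (K = 2k+1) after rotating it forward by r ≤ k, or
-- backward by t ≤ k, the factor x accounting for wrapping around the cycle.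
data Reachable (N k d : ℕ) : Set where
  forward  : ∀ r j → r ≤ k → j < ceilDiv2k+1 N k →
             r + j * suc (2 * k) ≡ d → Reachable N k d
  backward : ∀ t j x → t ≤ k → j < ceilDiv2k+1 N k →
             j * suc (2 * k) + x * N ≡ d + t → Reachable N k d

reachable : ∀ {N} k {d} → d < N → Reachable N k d
-- Cases: guard 0 steps back around the end of the cycle onto d; guard d / K
-- steps forward by d % K; guard d / K + 1 steps back onto d.
reachable {N} k {d} d<N with N ≤? d + k
... | yes N≤d+k = backward (N ∸ d) 0 1 (m≤n+o⇒m∸n≤o N d N≤d+k)
                    (below-ceilDiv2k+1 k 0 (≤-<-trans z≤n d<N))
                    (trans (+-identityʳ N) (sym (m+[n∸m]≡n (<⇒≤ d<N))))
... | no N≰d+k with ≤-<-connex (d % suc (2 * k)) k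
...   | inj₁ r≤k = forward (d % K) (d / K) r≤k
                     (below-ceilDiv2k+1 k (d / K) (≤-<-trans (m/n*n≤m d K) d<N))
                     (sym (m≡m%n+[m/n]*n d K))
  where K = suc (2 * k)
...   | inj₂ k<r = backward t (suc j) 0 t≤k
                     (below-ceilDiv2k+1 k (suc j) (subst (_< N) (sym next-guard) d+t<N))
                     (trans (+-identityʳ _) next-guard)
  where
  K = suc (2 * k)
  r = d % K
  j = d / K
  t = K ∸ r
  t≤k : t ≤ k
  t≤k = ≤-trans (∸-monoʳ-≤ K k<r)
          (≤-reflexive (trans (m+n∸m≡n k (k + 0)) (+-identityʳ k)))
  d+t<N : d + t < N
  d+t<N = ≤-<-trans (+-monoʳ-≤ d t≤k) (≰⇒> N≰d+k)
  next-guard : suc j * K ≡ d + t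
  next-guard = begin
    K + j * K         ≡⟨ cong (λ K′ → K′ + j * K) (sym (m∸n+n≡m (<⇒≤ (m%n<n d K)))) ⟩
    (t + r) + j * K   ≡⟨ rearrange t r (j * K) ⟩
    (r + j * K) + t   ≡⟨ cong (_+ t) (sym (m≡m%n+[m/n]*n d K)) ⟩
    d + t             ∎
    where
    open ≡-Reasoning
    rearrange : ∀ t r x → (t + r) + x ≡ (r + x) + t
    rearrange = solve-∀

module ClosedWalk {n} (G : Graph n) (m : ℕ) (walk : ℕ → Fin n)
  (step : ∀ a → Adj G (walk a) (walk (suc a)))
  (periodic : ∀ a x → walk (a + x * suc m) ≡ walk a) where

  walk-forward : ∀ t a → Within G t (walk a) (walk (a + t))
  walk-forward zero    a = cong walk (sym (+-identityʳ a))
  walk-forward (suc t) a = inj₂ (walk (suc a) , step a ,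
    subst (Within G t (walk (suc a))) (cong walk (sym (+-suc a t))) (walk-forward t (suc a)))

  walk-backward : ∀ t a → Within G t (walk (a + t)) (walk a)
  walk-backward zero    a = cong walk (+-identityʳ a)
  walk-backward (suc t) a = inj₂ (walk (a + t) ,
    subst (λ u → Adj G u (walk (a + t))) (cong walk (sym (+-suc a t))) (Graph.sym G (step (a + t))) ,
    walk-backward t a)

  offset-of : ∀ s p → Σ ℕ λ d → d < suc m × walk (s + d) ≡ walk p
  offset-of s p = e % N , m%n<n e N , (begin
    walk (s + e % N)                  ≡⟨ sym (periodic (s + e % N) (e / N)) ⟩
    walk (s + e % N + e / N * N)      ≡⟨ cong walk (+-assoc s (e % N) (e / N * N)) ⟩
    walk (s + (e % N + e / N * N))    ≡⟨ cong (λ e′ → walk (s + e′)) (sym (m≡m%n+[m/n]*n e N)) ⟩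
    walk (s + (p + s * m))            ≡⟨ cong walk (rearrange s p m) ⟩
    walk (p + s * N)                  ≡⟨ periodic p s ⟩
    walk p                            ∎)
    where
    N = suc m
    e = p + s * m
    open ≡-Reasoning
    rearrange : ∀ s p m → s + (p + s * m) ≡ p + s * suc m
    rearrange = solve-∀

  module Rotation (k : ℕ) where

    K : ℕ
    K = suc (2 * k)

    q : ℕ
    q = ceilDiv2k+1 (suc m) k

    guards : ℕ → Config n q
    guards s = tabulate (λ j → walk (s + toℕ j * K))

    lookup-guards : ∀ s j → lookup (guards s) j ≡ walk (s + toℕ j * K)
    lookup-guards s = lookup∘tabulate (λ j → walk (s + toℕ j * K))

    GuardsMove : ℕ → ℕ → Set
    GuardsMove s s′ = ∀ i → Within G k (walk (s + i * K)) (walk (s′ + i * K))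

    rotate-forward : ∀ {r} s → r ≤ k → GuardsMove s (s + r)
    rotate-forward {r} s r≤k i = Within-mono r≤k
      (subst (Within G r (walk (s + i * K))) (cong walk (rearrange s (i * K) r)) (walk-forward r (s + i * K)))
      where
      rearrange : ∀ s x r → s + x + r ≡ s + r + x
      rearrange = solve-∀

    -- Moving t steps backwards along a cycle of length suc m is moving t * m steps forwards.
    rotate-backward : ∀ {t} s → t ≤ k → GuardsMove s (s + t * m)
    rotate-backward {t} s t≤k i = Within-mono t≤k
      (subst (λ u → Within G t u (walk (s + t * m + i * K))) back-to-start (walk-backward t (s + t * m + i * K)))
      where
      rearrange : ∀ s t m x → s + t * m + x + t ≡ s + x + t * suc m
      rearrange = solve-∀
      back-to-start : walk (s + t * m + i * K + t) ≡ walk (s + i * K)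
      back-to-start = trans (cong walk (rearrange s t m (i * K))) (periodic (s + i * K) t)

    Guarded : ℕ → Fin n → Set
    Guarded s v = Σ (Fin q) λ j → walk (s + toℕ j * K) ≡ v

    guarded : ∀ s {j} → j < q → ∀ {v} → walk (s + j * K) ≡ v → Guarded s v
    guarded s j<q hit = fromℕ< j<q , trans (cong (λ j → walk (s + j * K)) (toℕ-fromℕ< j<q)) hit

    rotate-onto-offset : ∀ s {d} → d < suc m → Σ ℕ λ s′ → GuardsMove s s′ × Guarded s′ (walk (s + d))
    rotate-onto-offset s {d} d<N with reachable k d<N
    ... | forward r j r≤k j<q hit =
      s + r , rotate-forward s r≤k , guarded (s + r) j<q (cong walk (trans (+-assoc s r (j * K)) (cong (s +_) hit)))
    ... | backward t j x t≤k j<q hit =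
      s + t * m , rotate-backward s t≤k , guarded (s + t * m) j<q (begin
        walk (s + t * m + j * K)                ≡⟨ sym (periodic _ x) ⟩
        walk (s + t * m + j * K + x * suc m)    ≡⟨ cong walk (+-assoc (s + t * m) (j * K) (x * suc m)) ⟩
        walk (s + t * m + (j * K + x * suc m))  ≡⟨ cong (λ e → walk (s + t * m + e)) hit ⟩
        walk (s + t * m + (d + t))              ≡⟨ cong walk (rearrange s t m d) ⟩
        walk (s + d + t * suc m)                ≡⟨ periodic (s + d) t ⟩
        walk (s + d)                            ∎)
      where
      open ≡-Reasoning
      rearrange : ∀ s t m d → s + t * m + (d + t) ≡ s + d + t * suc m
      rearrange = solve-∀

    rotate-onto : (∀ v → ∃ λ p → walk p ≡ v) → ∀ s v → Σ ℕ λ s′ → GuardsMove s s′ × Guarded s′ v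
    rotate-onto onto s v with onto v
    ... | p , refl with offset-of s p
    ...   | d , d<N , hit with rotate-onto-offset s d<N
    ...     | s′ , moves , j , at = s′ , moves , j , trans at hit

    moves⇒transforms : ∀ {s s′} → GuardsMove s s′ → Transforms G k (guards s) (guards s′)
    moves⇒transforms {s} {s′} moves = id , λ i →
      subst₂ (Within G k) (sym (lookup-guards s i)) (sym (lookup-guards s′ i)) (moves (toℕ i))

    rotationFamily : (∀ v → ∃ λ p → walk p ≡ v) → EternalFamily G k q
    rotationFamily onto = record
      { Member    = λ D → ∃ λ s → D ≡ guards s
      ; nonempty  = guards 0 , 0 , refl
      ; dominates = λ { D (s , refl) v _ → dominated s v }
      ; respond   = λ { D (s , refl) v → response s v }
      }
      where
      dominated : ∀ s v → Σ (Fin q) λ j → Within G k (lookup (guards s) j) v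
      dominated s v with rotate-onto onto s v
      ... | s′ , moves , j , at = j , subst₂ (Within G k) (sym (lookup-guards s j)) at (moves (toℕ j))
      response : ∀ s v → Σ (Config n q) λ D′ → (∃ λ s′ → D′ ≡ guards s′) × v ∈ D′ × Transforms G k (guards s) D′
      response s v with rotate-onto onto s v
      ... | s′ , moves , j , at =
        guards s′ , (s′ , refl) , subst (_∈ guards s′) (trans (lookup-guards s′ j) at) (∈-lookup j (guards s′)) ,
        moves⇒transforms moves

module HamiltonianCycle {m} (G : Graph (suc m)) (c : Permutation′ (suc m))
  (adj : ∀ i → Adj G (c ⟨$⟩ʳ i) (c ⟨$⟩ʳ (suc (toℕ i) mod suc m))) where

  cycleWalk : ℕ → Fin (suc m)
  cycleWalk a = c ⟨$⟩ʳ (a mod suc m)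

  cycleWalk-cong : ∀ a b → a % suc m ≡ b % suc m → cycleWalk a ≡ cycleWalk b
  cycleWalk-cong a b eq = cong (c ⟨$⟩ʳ_) (fromℕ<-cong _ _ eq (m%n<n a (suc m)) (m%n<n b (suc m)))

  cycleWalk-step : ∀ a → Adj G (cycleWalk a) (cycleWalk (suc a))
  cycleWalk-step a = subst (Adj G (cycleWalk a)) (cycleWalk-cong (suc (toℕ (a mod suc m))) (suc a) suc-mod) (adj (a mod suc m))
    where
    suc-mod : suc (toℕ (a mod suc m)) % suc m ≡ suc a % suc m
    suc-mod = begin
      suc (toℕ (a mod suc m)) % suc m            ≡⟨ cong (λ r → suc r % suc m) (toℕ-fromℕ< (m%n<n a (suc m))) ⟩
      suc (a % suc m) % suc m                    ≡⟨ sym ([m+kn]%n≡m%n (suc (a % suc m)) (a / suc m) (suc m)) ⟩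
      suc (a % suc m + a / suc m * suc m) % suc m ≡⟨ cong (λ a′ → suc a′ % suc m) (sym (m≡m%n+[m/n]*n a (suc m))) ⟩
      suc a % suc m                              ∎
      where open ≡-Reasoning

  cycleWalk-periodic : ∀ a x → cycleWalk (a + x * suc m) ≡ cycleWalk a
  cycleWalk-periodic a x = cycleWalk-cong (a + x * suc m) a ([m+kn]%n≡m%n a x (suc m))

  cycleWalk-onto : ∀ v → ∃ λ p → cycleWalk p ≡ v
  cycleWalk-onto v = p , trans (cong (c ⟨$⟩ʳ_) p-mod) (inverseʳ c)
    where
    p = toℕ (c ⟨$⟩ˡ v)
    p-mod : p mod suc m ≡ c ⟨$⟩ˡ v
    p-mod = trans (fromℕ<-cong _ _ (m<n⇒m%n≡m (toℕ<n (c ⟨$⟩ˡ v))) _ (toℕ<n (c ⟨$⟩ˡ v)))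
                  (fromℕ<-toℕ (c ⟨$⟩ˡ v) (toℕ<n (c ⟨$⟩ˡ v)))

corollary1 : ∀ {n} (G : Graph n) → Hamiltonian G →
    ∀ (k : ℕ) → 1 ≤ k → EternalDomNumber≤ G k (ceilDiv2k+1 n k)
corollary1 {zero}  G ()
corollary1 {suc m} G (_ , c , adj) k _ = ceilDiv2k+1 (suc m) k , ≤-refl , rotationFamily cycleWalk-onto
  where
  open HamiltonianCycle G c adj
  open ClosedWalk G m cycleWalk cycleWalk-step cycleWalk-periodic
  open Rotation k
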